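{- Let $\mathscr{A}$ be a closed set of impartial games with misère quotient $(\mathcal{Q},\mathcal{P})$, quotient map $\Phi$, and transition algebra $T=T(\mathscr{A})$. Let $G$ be a game that has at least one option, with every option of $G$ lying in $\mathscr{A}$, and put $\mathscr{B}=\mathrm{cl}(\mathscr{A}\cup\{G\})$. For $x\in\mathcal{Q}$ the following are equivalent: (a) $\mathcal{Q}(\mathscr{B})\cong\mathcal{Q}(\mathscr{A})$ and $\Phi(G)=x$; precisely: for $K,K'\in\mathscr{A}$ one has $K\equiv_{\mathscr{A}}K'$ iff $K\equiv_{\mathscr{B}}K'$, every element of $\mathscr{B}$ is $\equiv_{\mathscr{B}}$-equivalent to an element of $\mathscr{A}$, and $G\equiv_{\mathscr{B}}H$ for every $H\in\mathscr{A}$ with $\Phi(H)=x$. (b) Both of the following hold: (i) $\Phi''G\subseteq\mathcal{M}_x$; and (ii) for each $(y,\mathcal{E})\in T$ and each integer $n\ge 0$ such that $x^{n+1}y\notin\mathcal{P}$, either $x^{n+1}y'\in\mathcal{P}$ for some $y'\in\mathcal{E}$, or $x^nx'y\in\mathcal{P}$ for some $x'\in\Phi''G$.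
   Context: All games are impartial; $G+H$ is the disjunctive sum, $n\cdot G$ the sum of $n$ copies of $G$. In misère play the last player to move loses; $o^-(G)\in\{\mathscr{P},\mathscr{N}\}$ is the misère outcome ($\mathscr{P}$ if the player not to move can force a win). A set of games is closed if it is closed under disjunctive sum and under taking options; $\mathrm{cl}(\mathscr{S})$ is the smallest closed set containing $\mathscr{S}$. For closed $\mathscr{C}$ and $G,H\in\mathscr{C}$, $G\equiv_{\mathscr{C}}H$ iff $o^-(G+X)=o^-(H+X)$ for all $X\in\mathscr{C}$; $\mathcal{Q}(\mathscr{C})=(\mathscr{C}/\equiv_{\mathscr{C}},\mathcal{P})$ with $\mathcal{P}$ the set of classes of misère $\mathscr{P}$-positions is the misère quotient (a commutative monoid with distinguished subset), and $\Phi:\mathscr{A}\to\mathcal{Q}$ is the quotient map for $\mathscr{A}$. For a game $G$ whose options lie in $\mathscr{A}$, $\Phi''G=\{\Phi(G'):G' \text{ an option of } G\}$. The meximal set of $x\in\mathcal{Q}$ is $\mathcal{M}_x=\{y\in\mathcal{Q}:\text{there is no } w\in\mathcal{Q}\text{ with both } xw\in\mathcal{P},\ yw\in\mathcal{P}\}$. The transition algebra of $\mathscr{A}$ is $T(\mathscr{A})=\{(\Phi(K),\Phi''K):K\in\mathscr{A}\}$. -}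

module Defs where

open import Data.Nat using (ℕ; zero; suc)
open import Data.List using (List; []; _∷_; _++_)
open import Data.List.Membership.Propositional using (_∈_)
open import Data.Product using (Σ; ∃; _×_; _,_)
open import Data.Sum using (_⊎_)
open import Data.Empty using (⊥)
open import Relation.Nullary using (¬_)
open import Relation.Binary.PropositionalEquality using (_≡_; _≢_)

data Game : Set where
  mk : List Game → Game

options : Game → List Game
options (mk gs) = gs

_isOptionOf_ : Game → Game → Set
G' isOptionOf G = G' ∈ options G

𝟎 : Game
𝟎 = mk []

mutual
  infixl 6 _⊕_
  _⊕_ : Game → Game → Game
  mk gs ⊕ mk hs = mk (lefts gs (mk hs) ++ rights (mk gs) hs)

  lefts : List Game → Game → List Game
  lefts [] h = []
  lefts (g ∷ gs) h = (g ⊕ h) ∷ lefts gs h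

  rights : Game → List Game → List Game
  rights g [] = []
  rights g (h ∷ hs) = (g ⊕ h) ∷ rights g hs

_·_ : ℕ → Game → Game
zero · G = 𝟎
suc n · G = G ⊕ (n · G)

-- Misère outcome: the player unable to move wins (last player to move loses).

data Outcome : Set where
  𝒫 𝒩 : Outcome

mutual
  o⁻ : Game → Outcome
  o⁻ (mk []) = 𝒩
  o⁻ (mk (g ∷ gs)) = allN (g ∷ gs)

  allN : List Game → Outcome
  allN [] = 𝒫
  allN (g ∷ gs) with o⁻ g
  ... | 𝒫 = 𝒩
  ... | 𝒩 = allN gs

GameSet : Set₁
GameSet = Game → Set

Closed : GameSet → Set
Closed C = (∀ {G H} → C G → C H → C (G ⊕ H))
         × (∀ {G G'} → C G → G' isOptionOf G → C G')

data cl (S : GameSet) : GameSet where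
  base : ∀ {G} → S G → cl S G
  sum  : ∀ {G H} → cl S G → cl S H → cl S (G ⊕ H)
  opt  : ∀ {G G'} → cl S G → G' isOptionOf G → cl S G'

_∪⁺_ : GameSet → Game → GameSet
(A ∪⁺ G) K = A K ⊎ K ≡ G

_≡[_]_ : Game → GameSet → Game → Set
G ≡[ C ] H = ∀ X → C X → o⁻ (G ⊕ X) ≡ o⁻ (H ⊕ X)

-- The misère quotient Q(A), as a setoid: elements are represented by
-- games of A, equality is ≡_A, product is induced by ⊕, and 𝒫-membership
-- is by misère outcome of a representative (all are invariant under ≡_A).

Q : GameSet → Set
Q A = Σ Game A

module Quotient (A : GameSet) where

  Φ : (K : Game) → A K → Q A
  Φ K k = K , k

  _≈_ : Q A → Q A → Set
  (X , _) ≈ (Y , _) = X ≡[ A ] Y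

  ⌊_⌋ : Q A → Game
  ⌊ X , _ ⌋ = X

  In𝒫 : Game → Set
  In𝒫 K = o⁻ K ≡ 𝒫

  Meximal : Q A → Q A → Set
  Meximal x y = ¬ (Σ (Q A) λ w → In𝒫 (⌊ x ⌋ ⊕ ⌊ w ⌋) × In𝒫 (⌊ y ⌋ ⊕ ⌊ w ⌋))

{-# OPTIONS --safe #-}
module Submission where

-- Both (a) and (b) amount to G and x being indistinguishable in every multiple: m·G ≡_A m·X
-- for all m, where X represents x. Up to rearranging sums, every game of B = cl(A ∪ {G}) has
-- the form m·G + L with L ∈ A, and replacing m·G by m·X then preserves all misère outcomes,
-- which gives (a); conversely (a) yields G ≡_B X, from which the multiples condition follows
-- by induction on m. Condition (b) is precisely what makes the step from n·G to (n+1)·G go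
-- through by induction on K ∈ A: when (n+1)·X + K is a 𝒫-position, meximality forbids a move
-- in G to a 𝒫-position, and when it is an 𝒩-position, (ii) provides a winning move.

open import Defs
open import Data.Nat using (ℕ; zero; suc; _+_)
open import Data.List using ([]; _∷_)
open import Data.List.Membership.Propositional using (_∈_)
open import Data.List.Membership.Propositional.Properties using (∈-++⁺ˡ; ∈-++⁺ʳ; ∈-++⁻)
open import Data.List.Relation.Unary.Any using (here; there)
open import Data.Product using (Σ; _×_; _,_; proj₁; proj₂)
open import Data.Sum using (_⊎_; inj₁; inj₂)
open import Data.Empty using (⊥-elim)
open import Relation.Nullary using (¬_)
open import Relation.Binary.PropositionalEquality using (_≡_; refl; sym; trans; module ≡-Reasoning)
open import Induction.WellFounded using (Acc; acc; WellFounded)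
open import Function.Bundles using (_⇔_; mk⇔)

options-wellFounded : WellFounded _isOptionOf_
options-wellFounded (mk gs) = acc (members-acc gs)
  where
  members-acc : ∀ gs {g} → g ∈ gs → Acc _isOptionOf_ g
  members-acc (g ∷ gs) (here refl) = options-wellFounded g
  members-acc (g ∷ gs) (there m)   = members-acc gs m

lefts⁻ : ∀ gs h {Z} → Z ∈ lefts gs h → Σ Game λ g → g ∈ gs × Z ≡ g ⊕ h
lefts⁻ (g ∷ gs) h (here refl) = g , here refl , refl
lefts⁻ (g ∷ gs) h (there m) with lefts⁻ gs h m
... | g′ , m′ , eq = g′ , there m′ , eq

rights⁻ : ∀ g hs {Z} → Z ∈ rights g hs → Σ Game λ h → h ∈ hs × Z ≡ g ⊕ h
rights⁻ g (h ∷ hs) (here refl) = h , here refl , refl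
rights⁻ g (h ∷ hs) (there m) with rights⁻ g hs m
... | h′ , m′ , eq = h′ , there m′ , eq

lefts⁺ : ∀ {gs g} h → g ∈ gs → (g ⊕ h) ∈ lefts gs h
lefts⁺ h (here refl) = here refl
lefts⁺ h (there m)   = there (lefts⁺ h m)

rights⁺ : ∀ g {hs h} → h ∈ hs → (g ⊕ h) ∈ rights g hs
rights⁺ g (here refl) = here refl
rights⁺ g (there m)   = there (rights⁺ g m)

⊕-option⁻ : ∀ G H {Z} → Z isOptionOf (G ⊕ H) →
  (Σ Game λ G′ → G′ isOptionOf G × Z ≡ G′ ⊕ H) ⊎ (Σ Game λ H′ → H′ isOptionOf H × Z ≡ G ⊕ H′)
⊕-option⁻ (mk gs) (mk hs) o with ∈-++⁻ (lefts gs (mk hs)) o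
... | inj₁ m = inj₁ (lefts⁻ gs (mk hs) m)
... | inj₂ m = inj₂ (rights⁻ (mk gs) hs m)

⊕-optionˡ : ∀ G H {G′} → G′ isOptionOf G → (G′ ⊕ H) isOptionOf (G ⊕ H)
⊕-optionˡ (mk gs) (mk hs) o = ∈-++⁺ˡ (lefts⁺ (mk hs) o)

⊕-optionʳ : ∀ G H {H′} → H′ isOptionOf H → (G ⊕ H′) isOptionOf (G ⊕ H)
⊕-optionʳ (mk gs) (mk hs) o = ∈-++⁺ʳ (lefts gs (mk hs)) (rights⁺ (mk gs) o)

Terminal : Game → Set
Terminal G = ∀ {G′} → ¬ G′ isOptionOf G

𝒩⇒¬𝒫 : ∀ {o} → o ≡ 𝒩 → ¬ o ≡ 𝒫
𝒩⇒¬𝒫 refl ()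

¬𝒫⇒𝒩 : ∀ {o} → ¬ o ≡ 𝒫 → o ≡ 𝒩
¬𝒫⇒𝒩 {𝒫} ¬𝒫 = ⊥-elim (¬𝒫 refl)
¬𝒫⇒𝒩 {𝒩} ¬𝒫 = refl

allN-𝒫⁻ : ∀ gs → allN gs ≡ 𝒫 → ∀ {g} → g ∈ gs → o⁻ g ≡ 𝒩
allN-𝒫⁻ (g ∷ gs) e m with o⁻ g in eq
allN-𝒫⁻ (g ∷ gs) () m           | 𝒫
allN-𝒫⁻ (g ∷ gs) e (here refl) | 𝒩 = eq
allN-𝒫⁻ (g ∷ gs) e (there m)   | 𝒩 = allN-𝒫⁻ gs e m

allN-𝒫⁺ : ∀ gs → (∀ {g} → g ∈ gs → o⁻ g ≡ 𝒩) → allN gs ≡ 𝒫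
allN-𝒫⁺ []       all𝒩 = refl
allN-𝒫⁺ (g ∷ gs) all𝒩 with o⁻ g in eq
... | 𝒫 with () ← trans (sym eq) (all𝒩 (here refl))
... | 𝒩 = allN-𝒫⁺ gs (λ m → all𝒩 (there m))

allN-𝒩⁻ : ∀ gs → allN gs ≡ 𝒩 → Σ Game λ g → g ∈ gs × o⁻ g ≡ 𝒫
allN-𝒩⁻ (g ∷ gs) e with o⁻ g in eq
... | 𝒫 = g , here refl , eq
... | 𝒩 with allN-𝒩⁻ gs e
...   | g′ , m , p = g′ , there m , p

allN-𝒩⁺ : ∀ gs {g} → g ∈ gs → o⁻ g ≡ 𝒫 → allN gs ≡ 𝒩
allN-𝒩⁺ (g ∷ gs) m p with o⁻ g in eq
allN-𝒩⁺ (g ∷ gs) m           p | 𝒫 = refl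
allN-𝒩⁺ (g ∷ gs) (here refl) p | 𝒩 with () ← trans (sym p) eq
allN-𝒩⁺ (g ∷ gs) (there m)   p | 𝒩 = allN-𝒩⁺ gs m p

𝒫-intro : ∀ G {G₀} → G₀ isOptionOf G → (∀ {G′} → G′ isOptionOf G → o⁻ G′ ≡ 𝒩) → o⁻ G ≡ 𝒫
𝒫-intro (mk (g ∷ gs)) _ = allN-𝒫⁺ (g ∷ gs)

𝒫⇒options-𝒩 : ∀ G → o⁻ G ≡ 𝒫 → ∀ {G′} → G′ isOptionOf G → o⁻ G′ ≡ 𝒩
𝒫⇒options-𝒩 (mk (g ∷ gs)) = allN-𝒫⁻ (g ∷ gs)

𝒫⇒option : ∀ G → o⁻ G ≡ 𝒫 → Σ Game λ G′ → G′ isOptionOf G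
𝒫⇒option (mk (g ∷ gs)) _ = g , here refl

𝒩-intro : ∀ G {G′} → G′ isOptionOf G → o⁻ G′ ≡ 𝒫 → o⁻ G ≡ 𝒩
𝒩-intro (mk (g ∷ gs)) = allN-𝒩⁺ (g ∷ gs)

𝒩-elim : ∀ G → o⁻ G ≡ 𝒩 → Terminal G ⊎ (Σ Game λ G′ → G′ isOptionOf G × o⁻ G′ ≡ 𝒫)
𝒩-elim (mk [])       _ = inj₁ λ ()
𝒩-elim (mk (g ∷ gs)) e = inj₂ (allN-𝒩⁻ (g ∷ gs) e)

_OptionOutcomes⊆_ : Game → Game → Set
G OptionOutcomes⊆ H = ∀ {G′} → G′ isOptionOf G → Σ Game λ H′ → H′ isOptionOf H × o⁻ G′ ≡ o⁻ H′

𝒫-transfer : ∀ {G H} → G OptionOutcomes⊆ H → H OptionOutcomes⊆ G → o⁻ G ≡ 𝒫 → o⁻ H ≡ 𝒫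
𝒫-transfer {G} {H} G⊆H H⊆G G𝒫 = 𝒫-intro H (proj₁ (proj₂ (G⊆H (proj₂ (𝒫⇒option G G𝒫))))) options-𝒩
  where
  options-𝒩 : ∀ {H′} → H′ isOptionOf H → o⁻ H′ ≡ 𝒩
  options-𝒩 oH′ = let (G′ , oG′ , e) = H⊆G oH′ in trans e (𝒫⇒options-𝒩 G G𝒫 oG′)

o⁻-cong : ∀ {G H} → G OptionOutcomes⊆ H → H OptionOutcomes⊆ G → o⁻ G ≡ o⁻ H
o⁻-cong {G} {H} G⊆H H⊆G with o⁻ G in eG
... | 𝒫 = sym (𝒫-transfer {G} {H} G⊆H H⊆G eG)
... | 𝒩 with o⁻ H in eH
...   | 𝒩 = refl
...   | 𝒫 with () ← trans (sym eG) (𝒫-transfer {H} {G} H⊆G G⊆H eH)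

-- Sums of game trees are associative, commutative and unital only up to bisimilarity.
infix 4 _~_
data _~_ : Game → Game → Set where
  bis : ∀ {G H} → (∀ {G′} → G′ isOptionOf G → Σ Game λ H′ → H′ isOptionOf H × G′ ~ H′)
                → (∀ {H′} → H′ isOptionOf H → Σ Game λ G′ → G′ isOptionOf G × G′ ~ H′)
                → G ~ H

~-refl : ∀ {G} → G ~ G
~-refl {G} = go (options-wellFounded G)
  where
  go : ∀ {G} → Acc _isOptionOf_ G → G ~ G
  go (acc rec) = bis (λ o → _ , o , go (rec o)) (λ o → _ , o , go (rec o))

~-sym : ∀ {G H} → G ~ H → H ~ G
~-sym (bis f b) = bis (λ o → let (G′ , oG′ , d) = b o in G′ , oG′ , ~-sym d)
                      (λ o → let (H′ , oH′ , d) = f o in H′ , oH′ , ~-sym d)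

~-trans : ∀ {G H K} → G ~ H → H ~ K → G ~ K
~-trans (bis f b) (bis f′ b′) =
  bis (λ o → let (_ , oH′ , d) = f o ; (K′ , oK′ , d′) = f′ oH′ in K′ , oK′ , ~-trans d d′)
      (λ o → let (_ , oH′ , d′) = b′ o ; (G′ , oG′ , d) = b oH′ in G′ , oG′ , ~-trans d d′)

o⁻-resp-~ : ∀ {G H} → G ~ H → o⁻ G ≡ o⁻ H
o⁻-resp-~ {G} {H} (bis f b) =
  o⁻-cong {G} {H} (λ o → let (H′ , oH′ , d) = f o in H′ , oH′ , o⁻-resp-~ d)
                  (λ o → let (G′ , oG′ , d) = b o in G′ , oG′ , sym (o⁻-resp-~ d))

⊕-cong : ∀ {G G′ H H′} → G ~ G′ → H ~ H′ → G ⊕ H ~ G′ ⊕ H′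
⊕-cong {G} {_} {H} = go (options-wellFounded G) (options-wellFounded H)
  where
  go : ∀ {G G′ H H′} → Acc _isOptionOf_ G → Acc _isOptionOf_ H → G ~ G′ → H ~ H′ → G ⊕ H ~ G′ ⊕ H′
  go {G} {G′} {H} {H′} aG@(acc recG) aH@(acc recH) p@(bis f b) q@(bis f′ b′) = bis forth back
    where
    forth : ∀ {Z} → Z isOptionOf (G ⊕ H) → Σ Game λ W → W isOptionOf (G′ ⊕ H′) × Z ~ W
    forth o with ⊕-option⁻ G H o
    ... | inj₁ (_ , oG , refl) = let (g′ , og′ , d) = f oG
                                 in g′ ⊕ H′ , ⊕-optionˡ G′ H′ og′ , go (recG oG) aH d q
    ... | inj₂ (_ , oH , refl) = let (h′ , oh′ , d) = f′ oH
                                 in G′ ⊕ h′ , ⊕-optionʳ G′ H′ oh′ , go aG (recH oH) p d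
    back : ∀ {W} → W isOptionOf (G′ ⊕ H′) → Σ Game λ Z → Z isOptionOf (G ⊕ H) × Z ~ W
    back o with ⊕-option⁻ G′ H′ o
    ... | inj₁ (_ , oG′ , refl) = let (g , og , d) = b oG′
                                  in g ⊕ H , ⊕-optionˡ G H og , go (recG og) aH d q
    ... | inj₂ (_ , oH′ , refl) = let (h , oh , d) = b′ oH′
                                  in G ⊕ h , ⊕-optionʳ G H oh , go aG (recH oh) p d

⊕-comm : ∀ G H → G ⊕ H ~ H ⊕ G
⊕-comm G H = go (options-wellFounded G) (options-wellFounded H)
  where
  go : ∀ {G H} → Acc _isOptionOf_ G → Acc _isOptionOf_ H → G ⊕ H ~ H ⊕ G
  go {G} {H} (acc recG) (acc recH) = bis forth back
    where
    forth : ∀ {Z} → Z isOptionOf (G ⊕ H) → Σ Game λ W → W isOptionOf (H ⊕ G) × Z ~ W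
    forth o with ⊕-option⁻ G H o
    ... | inj₁ (g , oG , refl) = H ⊕ g , ⊕-optionʳ H G oG , go (recG oG) (acc recH)
    ... | inj₂ (h , oH , refl) = h ⊕ G , ⊕-optionˡ H G oH , go (acc recG) (recH oH)
    back : ∀ {W} → W isOptionOf (H ⊕ G) → Σ Game λ Z → Z isOptionOf (G ⊕ H) × Z ~ W
    back o with ⊕-option⁻ H G o
    ... | inj₁ (h , oH , refl) = G ⊕ h , ⊕-optionʳ G H oH , go (acc recG) (recH oH)
    ... | inj₂ (g , oG , refl) = g ⊕ H , ⊕-optionˡ G H oG , go (recG oG) (acc recH)

⊕-assoc : ∀ G H K → (G ⊕ H) ⊕ K ~ G ⊕ (H ⊕ K)
⊕-assoc G H K = go (options-wellFounded G) (options-wellFounded H) (options-wellFounded K)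
  where
  go : ∀ {G H K} → Acc _isOptionOf_ G → Acc _isOptionOf_ H → Acc _isOptionOf_ K →
       (G ⊕ H) ⊕ K ~ G ⊕ (H ⊕ K)
  go {G} {H} {K} aG@(acc recG) aH@(acc recH) aK@(acc recK) = bis forth back
    where
    forth : ∀ {Z} → Z isOptionOf ((G ⊕ H) ⊕ K) → Σ Game λ W → W isOptionOf (G ⊕ (H ⊕ K)) × Z ~ W
    forth o with ⊕-option⁻ (G ⊕ H) K o
    ... | inj₂ (k , oK , refl) =
      G ⊕ (H ⊕ k) , ⊕-optionʳ G (H ⊕ K) (⊕-optionʳ H K oK) , go aG aH (recK oK)
    ... | inj₁ (_ , oGH , refl) with ⊕-option⁻ G H oGH
    ...   | inj₁ (g , oG , refl) = g ⊕ (H ⊕ K) , ⊕-optionˡ G (H ⊕ K) oG , go (recG oG) aH aK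
    ...   | inj₂ (h , oH , refl) =
      G ⊕ (h ⊕ K) , ⊕-optionʳ G (H ⊕ K) (⊕-optionˡ H K oH) , go aG (recH oH) aK
    back : ∀ {W} → W isOptionOf (G ⊕ (H ⊕ K)) → Σ Game λ Z → Z isOptionOf ((G ⊕ H) ⊕ K) × Z ~ W
    back o with ⊕-option⁻ G (H ⊕ K) o
    ... | inj₁ (g , oG , refl) =
      (g ⊕ H) ⊕ K , ⊕-optionˡ (G ⊕ H) K (⊕-optionˡ G H oG) , go (recG oG) aH aK
    ... | inj₂ (_ , oHK , refl) with ⊕-option⁻ H K oHK
    ...   | inj₁ (h , oH , refl) =
      (G ⊕ h) ⊕ K , ⊕-optionˡ (G ⊕ H) K (⊕-optionʳ G H oH) , go aG (recH oH) aK
    ...   | inj₂ (k , oK , refl) = (G ⊕ H) ⊕ k , ⊕-optionʳ (G ⊕ H) K oK , go aG aH (recK oK)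

⊕-identityˡ : ∀ G → 𝟎 ⊕ G ~ G
⊕-identityˡ G = go (options-wellFounded G)
  where
  go : ∀ {G} → Acc _isOptionOf_ G → 𝟎 ⊕ G ~ G
  go {G} (acc rec) = bis forth (λ o → 𝟎 ⊕ _ , ⊕-optionʳ 𝟎 G o , go (rec o))
    where
    forth : ∀ {Z} → Z isOptionOf (𝟎 ⊕ G) → Σ Game λ W → W isOptionOf G × Z ~ W
    forth o with ⊕-option⁻ 𝟎 G o
    ... | inj₂ (g , oG , refl) = g , oG , go (rec oG)

⊕-identityʳ : ∀ G → G ⊕ 𝟎 ~ G
⊕-identityʳ G = ~-trans (⊕-comm G 𝟎) (⊕-identityˡ G)

⊕-swapˡ : ∀ G H K → G ⊕ (H ⊕ K) ~ H ⊕ (G ⊕ K)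
⊕-swapˡ G H K = ~-trans (~-sym (⊕-assoc G H K)) (~-trans (⊕-cong (⊕-comm G H) ~-refl) (⊕-assoc H G K))

⊕-medial : ∀ G H K L → (G ⊕ H) ⊕ (K ⊕ L) ~ (G ⊕ K) ⊕ (H ⊕ L)
⊕-medial G H K L =
  ~-trans (⊕-assoc G H (K ⊕ L)) (~-trans (⊕-cong ~-refl (⊕-swapˡ H K L)) (~-sym (⊕-assoc G K (H ⊕ L))))

·-additive : ∀ m n G → m · G ⊕ n · G ~ (m + n) · G
·-additive zero    n G = ⊕-identityˡ (n · G)
·-additive (suc m) n G = ~-trans (⊕-assoc G (m · G) (n · G)) (⊕-cong ~-refl (·-additive m n G))

·⊕-additive : ∀ m L n L′ G → (m · G ⊕ L) ⊕ (n · G ⊕ L′) ~ (m + n) · G ⊕ (L ⊕ L′)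
·⊕-additive m L n L′ G = ~-trans (⊕-medial (m · G) L (n · G) L′) (⊕-cong (·-additive m n G) ~-refl)

1·⊕𝟎-identity : ∀ G → 1 · G ⊕ 𝟎 ~ G
1·⊕𝟎-identity G = ~-trans (⊕-identityʳ (G ⊕ 𝟎)) (⊕-identityʳ G)

·-option⁻ : ∀ n G {Z} → Z isOptionOf (suc n · G) → Σ Game λ G′ → G′ isOptionOf G × Z ~ n · G ⊕ G′
·-option⁻ n G o with ⊕-option⁻ G (n · G) o
·-option⁻ n       G o | inj₁ (G′ , oG′ , refl) = G′ , oG′ , ⊕-comm G′ (n · G)
·-option⁻ (suc n) G o | inj₂ (_ , o′ , refl) with ·-option⁻ n G o′
... | G′ , oG′ , d = G′ , oG′ , ~-trans (⊕-cong ~-refl d) (~-sym (⊕-assoc G (n · G) G′))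

·⊕-option⁻ : ∀ m G K {Z} → Z isOptionOf (m · G ⊕ K) →
  (Σ ℕ λ n → m ≡ suc n × Σ Game λ G′ → G′ isOptionOf G × Z ~ n · G ⊕ (G′ ⊕ K))
  ⊎ (Σ Game λ K′ → K′ isOptionOf K × Z ≡ m · G ⊕ K′)
·⊕-option⁻ m G K o with ⊕-option⁻ (m · G) K o
·⊕-option⁻ m       G K o | inj₂ K-move = inj₂ K-move
·⊕-option⁻ (suc n) G K o | inj₁ (_ , o′ , refl) with ·-option⁻ n G o′
... | G′ , oG′ , d = inj₁ (n , refl , G′ , oG′ , ~-trans (⊕-cong d ~-refl) (⊕-assoc (n · G) G′ K))

·⊕-option⁺ : ∀ n G K {G′} → G′ isOptionOf G →
             Σ Game λ Z → Z isOptionOf (suc n · G ⊕ K) × Z ~ n · G ⊕ (G′ ⊕ K)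
·⊕-option⁺ n G K {G′} oG′ =
  (G′ ⊕ n · G) ⊕ K , ⊕-optionˡ (suc n · G) K (⊕-optionˡ G (n · G) oG′) ,
  ~-trans (⊕-cong (⊕-comm G′ (n · G)) ~-refl) (⊕-assoc (n · G) G′ K)

𝟎∈option-closed : {A : GameSet} → (∀ {G G′} → A G → G′ isOptionOf G → A G′) → ∀ {K} → A K → A 𝟎
𝟎∈option-closed closed {mk []}       K∈A = K∈A
𝟎∈option-closed closed {mk (g ∷ gs)} K∈A = 𝟎∈option-closed closed (closed K∈A (here refl))

module Extension {A : GameSet} (A-closed : Closed A) (𝟎∈A : A 𝟎)
                 (G : Game) (options∈A : ∀ {G′} → G′ isOptionOf G → A G′) where

  open Quotient A using (Φ; Meximal; In𝒫)

  ⊕∈A : ∀ {K L} → A K → A L → A (K ⊕ L)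
  ⊕∈A = proj₁ A-closed

  option∈A : ∀ {K K′} → A K → K′ isOptionOf K → A K′
  option∈A = proj₂ A-closed

  B : GameSet
  B = cl (A ∪⁺ G)

  ·G∈B : ∀ m → B (m · G)
  ·G∈B zero    = base (inj₁ 𝟎∈A)
  ·G∈B (suc m) = sum (base (inj₂ refl)) (·G∈B m)

  record NormalForm (Y : Game) : Set where
    constructor normal
    field
      copies : ℕ
      rest   : Game
      rest∈A : A rest
      shape  : Y ~ copies · G ⊕ rest

  normal-⊕ : ∀ {Y Z} → NormalForm Y → NormalForm Z → NormalForm (Y ⊕ Z)
  normal-⊕ (normal m L L∈A d) (normal n L′ L′∈A d′) =
    normal (m + n) (L ⊕ L′) (⊕∈A L∈A L′∈A) (~-trans (⊕-cong d d′) (·⊕-additive m L n L′ G))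

  normal-option : ∀ {Y Y′} → NormalForm Y → Y′ isOptionOf Y → NormalForm Y′
  normal-option (normal m L L∈A (bis forth _)) o with forth o
  ... | Z , oZ , d with ·⊕-option⁻ m G L oZ
  ...   | inj₁ (n , refl , G′ , oG′ , d′) = normal n (G′ ⊕ L) (⊕∈A (options∈A oG′) L∈A) (~-trans d d′)
  ...   | inj₂ (L′ , oL′ , refl)          = normal m L′ (option∈A L∈A oL′) d

  normal-A : ∀ {K} → A K → NormalForm K
  normal-A {K} K∈A = normal 0 K K∈A (~-sym (⊕-identityˡ K))

  normal-G : NormalForm G
  normal-G = normal 1 𝟎 𝟎∈A (~-sym (1·⊕𝟎-identity G))

  normalForm : ∀ {Y} → B Y → NormalForm Y
  normalForm (base (inj₁ Y∈A)) = normal-A Y∈A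
  normalForm (base (inj₂ refl)) = normal-G
  normalForm (sum Y∈B Z∈B)     = normal-⊕ (normalForm Y∈B) (normalForm Z∈B)
  normalForm (opt Y∈B o)       = normal-option (normalForm Y∈B) o

  module Replacement {X : Game} (X∈A : A X) where

    ·X∈A : ∀ m → A (m · X)
    ·X∈A zero    = 𝟎∈A
    ·X∈A (suc m) = ⊕∈A X∈A (·X∈A m)

    MultiplesIndistinguishable : Set
    MultiplesIndistinguishable = ∀ m → (m · G) ≡[ A ] (m · X)

    OptionsMeximal : Set
    OptionsMeximal = ∀ {G′} (o : G′ isOptionOf G) → Meximal (X , X∈A) (Φ G′ (options∈A o))

    TransitionCondition : Set
    TransitionCondition = ∀ K → A K → (n : ℕ) → ¬ In𝒫 (suc n · X ⊕ K) →
      Σ Game (λ K′ → K′ isOptionOf K × In𝒫 (suc n · X ⊕ K′))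
      ⊎ Σ Game (λ G′ → G′ isOptionOf G × In𝒫 (n · X ⊕ G′ ⊕ K))

    open ≡-Reasoning

    G-move-outcome : ∀ n {K G′ Z} → (n · G) ≡[ A ] (n · X) → A K → G′ isOptionOf G →
                     Z ~ n · G ⊕ (G′ ⊕ K) → o⁻ Z ≡ o⁻ (n · X ⊕ G′ ⊕ K)
    G-move-outcome n {K} {G′} {Z} same K∈A oG′ d = begin
      o⁻ Z                  ≡⟨ o⁻-resp-~ d ⟩
      o⁻ (n · G ⊕ (G′ ⊕ K)) ≡⟨ same (G′ ⊕ K) (⊕∈A (options∈A oG′) K∈A) ⟩
      o⁻ (n · X ⊕ (G′ ⊕ K)) ≡⟨ o⁻-resp-~ (~-sym (⊕-assoc (n · X) G′ K)) ⟩
      o⁻ (n · X ⊕ G′ ⊕ K)   ∎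

    meximal⇒¬both-𝒫 : OptionsMeximal → ∀ n {K G′} → A K → G′ isOptionOf G →
                      In𝒫 (suc n · X ⊕ K) → ¬ In𝒫 (n · X ⊕ G′ ⊕ K)
    meximal⇒¬both-𝒫 mex n {K} {G′} K∈A oG′ X-𝒫 G′-𝒫 = mex oG′
      ( (n · X ⊕ K , ⊕∈A (·X∈A n) K∈A)
      , trans (o⁻-resp-~ (~-sym (⊕-assoc X (n · X) K))) X-𝒫
      , trans (o⁻-resp-~ (~-trans (⊕-swapˡ G′ (n · X) K) (~-sym (⊕-assoc (n · X) G′ K)))) G′-𝒫 )

    multiples-step : ∀ {G₀} → G₀ isOptionOf G → OptionsMeximal → TransitionCondition →
                     ∀ n → (n · G) ≡[ A ] (n · X) → (suc n · G) ≡[ A ] (suc n · X)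
    multiples-step oG₀ mex tc n same K K∈A = go (options-wellFounded K) K∈A
      where
      go : ∀ {K} → Acc _isOptionOf_ K → A K → o⁻ (suc n · G ⊕ K) ≡ o⁻ (suc n · X ⊕ K)
      go {K} (acc rec) K∈A with o⁻ (suc n · X ⊕ K) in X-outcome
      ... | 𝒫 = 𝒫-intro (suc n · G ⊕ K) (proj₁ (proj₂ (·⊕-option⁺ n G K oG₀))) options-𝒩
        where
        options-𝒩 : ∀ {Z} → Z isOptionOf (suc n · G ⊕ K) → o⁻ Z ≡ 𝒩
        options-𝒩 o with ·⊕-option⁻ (suc n) G K o
        ... | inj₁ (_ , refl , G′ , oG′ , d) =
          trans (G-move-outcome n same K∈A oG′ d) (¬𝒫⇒𝒩 (meximal⇒¬both-𝒫 mex n K∈A oG′ X-outcome))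
        ... | inj₂ (K′ , oK′ , refl) =
          trans (go (rec oK′) (option∈A K∈A oK′))
                (𝒫⇒options-𝒩 (suc n · X ⊕ K) X-outcome (⊕-optionʳ (suc n · X) K oK′))
      ... | 𝒩 with tc K K∈A n (𝒩⇒¬𝒫 X-outcome)
      ...   | inj₁ (K′ , oK′ , P) =
        𝒩-intro (suc n · G ⊕ K) (⊕-optionʳ (suc n · G) K oK′) (trans (go (rec oK′) (option∈A K∈A oK′)) P)
      ...   | inj₂ (G′ , oG′ , P) =
        let (Z , oZ , d) = ·⊕-option⁺ n G K oG′
        in 𝒩-intro (suc n · G ⊕ K) oZ (trans (G-move-outcome n same K∈A oG′ d) P)

    multiples-indistinguishable : ∀ {G₀} → G₀ isOptionOf G → OptionsMeximal → TransitionCondition →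
                                  MultiplesIndistinguishable
    multiples-indistinguishable oG₀ mex tc zero    K K∈A = refl
    multiples-indistinguishable oG₀ mex tc (suc n) =
      multiples-step oG₀ mex tc n (multiples-indistinguishable oG₀ mex tc n)

    ≡[B]⇒multiples-indistinguishable : G ≡[ B ] X → MultiplesIndistinguishable
    ≡[B]⇒multiples-indistinguishable G≡X zero    K K∈A = refl
    ≡[B]⇒multiples-indistinguishable G≡X (suc m) K K∈A = begin
      o⁻ ((G ⊕ m · G) ⊕ K) ≡⟨ o⁻-resp-~ (⊕-assoc G (m · G) K) ⟩
      o⁻ (G ⊕ (m · G ⊕ K)) ≡⟨ G≡X (m · G ⊕ K) (sum (·G∈B m) (base (inj₁ K∈A))) ⟩
      o⁻ (X ⊕ (m · G ⊕ K)) ≡⟨ o⁻-resp-~ (⊕-swapˡ X (m · G) K) ⟩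
      o⁻ (m · G ⊕ (X ⊕ K)) ≡⟨ ≡[B]⇒multiples-indistinguishable G≡X m (X ⊕ K) (⊕∈A X∈A K∈A) ⟩
      o⁻ (m · X ⊕ (X ⊕ K)) ≡⟨ o⁻-resp-~ (~-trans (⊕-swapˡ (m · X) X K) (~-sym (⊕-assoc X (m · X) K))) ⟩
      o⁻ ((X ⊕ m · X) ⊕ K) ∎

    ≡[B]⇒options-meximal : G ≡[ B ] X → OptionsMeximal
    ≡[B]⇒options-meximal G≡X oG′ ((W , W∈A) , XW-𝒫 , G′W-𝒫) =
      𝒩⇒¬𝒫 (𝒩-intro (G ⊕ W) (⊕-optionˡ G W oG′) G′W-𝒫) (trans (G≡X W (base (inj₁ W∈A))) XW-𝒫)

    multiples⇒transition-condition : ∀ {G₀} → G₀ isOptionOf G → MultiplesIndistinguishable →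
                                     TransitionCondition
    multiples⇒transition-condition oG₀ same K K∈A n ¬𝒫
      with 𝒩-elim (suc n · G ⊕ K) (trans (same (suc n) K K∈A) (¬𝒫⇒𝒩 ¬𝒫))
    ... | inj₁ terminal = ⊥-elim (terminal (proj₁ (proj₂ (·⊕-option⁺ n G K oG₀))))
    ... | inj₂ (Z , oZ , P) with ·⊕-option⁻ (suc n) G K oZ
    ...   | inj₁ (_ , refl , G′ , oG′ , d) =
      inj₂ (G′ , oG′ , trans (sym (G-move-outcome n (same n) K∈A oG′ d)) P)
    ...   | inj₂ (K′ , oK′ , refl) =
      inj₁ (K′ , oK′ , trans (sym (same (suc n) K′ (option∈A K∈A oK′))) P)

    substitute : ∀ {Y} → NormalForm Y → Game
    substitute (normal m L _ _) = m · X ⊕ L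

    substitute∈A : ∀ {Y} (nY : NormalForm Y) → A (substitute nY)
    substitute∈A (normal m _ L∈A _) = ⊕∈A (·X∈A m) L∈A

    module _ (same : MultiplesIndistinguishable) where

      o⁻-substitute : ∀ {Y} (nY : NormalForm Y) → o⁻ Y ≡ o⁻ (substitute nY)
      o⁻-substitute (normal m L L∈A d) = trans (o⁻-resp-~ d) (same m L L∈A)

      o⁻-⊕-substitute : ∀ {Y Z} (nY : NormalForm Y) (nZ : NormalForm Z) →
                        o⁻ (Y ⊕ Z) ≡ o⁻ (substitute nY ⊕ substitute nZ)
      o⁻-⊕-substitute nY@(normal m L _ _) nZ@(normal n L′ _ _) =
        trans (o⁻-substitute (normal-⊕ nY nZ)) (o⁻-resp-~ (~-sym (·⊕-additive m L n L′ X)))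

      o⁻-⊕-substituteʳ : ∀ {K Z} → A K → (nZ : NormalForm Z) → o⁻ (K ⊕ Z) ≡ o⁻ (K ⊕ substitute nZ)
      o⁻-⊕-substituteʳ {K} K∈A nZ =
        trans (o⁻-⊕-substitute (normal-A K∈A) nZ) (o⁻-resp-~ (⊕-cong (⊕-identityˡ K) ~-refl))

      ≡[A]⇔≡[B] : ∀ K K′ → A K → A K′ → (K ≡[ A ] K′ ⇔ K ≡[ B ] K′)
      ≡[A]⇔≡[B] K K′ K∈A K′∈A = mk⇔ to (λ K≡K′ Y Y∈A → K≡K′ Y (base (inj₁ Y∈A)))
        where
        to : K ≡[ A ] K′ → K ≡[ B ] K′
        to K≡K′ Y Y∈B = let nY = normalForm Y∈B in begin
          o⁻ (K ⊕ Y)               ≡⟨ o⁻-⊕-substituteʳ K∈A nY ⟩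
          o⁻ (K ⊕ substitute nY)   ≡⟨ K≡K′ (substitute nY) (substitute∈A nY) ⟩
          o⁻ (K′ ⊕ substitute nY)  ≡⟨ sym (o⁻-⊕-substituteʳ K′∈A nY) ⟩
          o⁻ (K′ ⊕ Y)              ∎

      ≡[B]-representative∈A : ∀ K → B K → Σ Game (λ H → A H × K ≡[ B ] H)
      ≡[B]-representative∈A K K∈B = substitute nK , substitute∈A nK , K≡substitute
        where
        nK = normalForm K∈B
        K≡substitute : K ≡[ B ] substitute nK
        K≡substitute Y Y∈B = let nY = normalForm Y∈B in begin
          o⁻ (K ⊕ Y)                         ≡⟨ o⁻-⊕-substitute nK nY ⟩
          o⁻ (substitute nK ⊕ substitute nY) ≡⟨ sym (o⁻-⊕-substituteʳ (substitute∈A nK) nY) ⟩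
          o⁻ (substitute nK ⊕ Y)             ∎

      G≡[B]-class-of-X : ∀ H → A H → H ≡[ A ] X → G ≡[ B ] H
      G≡[B]-class-of-X H H∈A H≡X Y Y∈B = let nY = normalForm Y∈B in begin
        o⁻ (G ⊕ Y)                            ≡⟨ o⁻-⊕-substitute normal-G nY ⟩
        o⁻ ((1 · X ⊕ 𝟎) ⊕ substitute nY)      ≡⟨ o⁻-resp-~ (⊕-cong (1·⊕𝟎-identity X) ~-refl) ⟩
        o⁻ (X ⊕ substitute nY)                ≡⟨ sym (H≡X (substitute nY) (substitute∈A nY)) ⟩
        o⁻ (H ⊕ substitute nY)                ≡⟨ sym (o⁻-⊕-substituteʳ H∈A nY) ⟩
        o⁻ (H ⊕ Y)                            ∎

theorem5p7 : (A : GameSet) → Closed A →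
    (G : Game) → Σ Game (λ G' → G' isOptionOf G) →
    (optA : ∀ {G'} → G' isOptionOf G → A G') →
    (x : Q A) →
    let open Quotient A
        B = cl (A ∪⁺ G)
        X = ⌊ x ⌋
    in ((∀ K K' → A K → A K' → (K ≡[ A ] K' ⇔ K ≡[ B ] K'))
        × (∀ K → B K → Σ Game (λ H → A H × K ≡[ B ] H))
        × (∀ H → (h : A H) → Φ H h ≈ x → G ≡[ B ] H))
       ⇔
       ((∀ {G'} → (o : G' isOptionOf G) → Meximal x (Φ G' (optA o)))
        × (∀ K → A K → (n : ℕ) → ¬ In𝒫 (suc n · X ⊕ K) →
             Σ Game (λ K' → K' isOptionOf K × In𝒫 (suc n · X ⊕ K'))
             ⊎ Σ Game (λ G' → G' isOptionOf G × In𝒫 (n · X ⊕ G' ⊕ K))))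
theorem5p7 A A-closed G (_ , oG₀) options∈A (X , X∈A) = mk⇔
  (λ (_ , _ , G≡[B]-class) →
     let G≡X = G≡[B]-class X X∈A (λ _ _ → refl)
     in ≡[B]⇒options-meximal G≡X
      , multiples⇒transition-condition oG₀ (≡[B]⇒multiples-indistinguishable G≡X))
  (λ (mex , tc) →
     let same = multiples-indistinguishable oG₀ mex tc
     in ≡[A]⇔≡[B] same , ≡[B]-representative∈A same , G≡[B]-class-of-X same)
  where
  open Extension A-closed (𝟎∈option-closed (proj₂ A-closed) X∈A) G options∈A
  open Replacement X∈A
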